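{- Let $n\ge 2$. There is a bijection between the spanning paths of the $n$-Roberts graph whose two endpoints are antipodal vertices (up to automorphisms of the graph) and the chord diagrams of a $2n$-gon having exactly one loop (up to dihedral symmetry).
   Context: The $n$-Roberts graph has $2n$ vertices arranged as $n$ antipodal pairs (corresponding to pairs of opposite facets of the $n$-cube), with every pair of vertices joined by an edge except antipodal pairs. A chord diagram of a $2n$-gon is a perfect matching of its $2n$ vertices; a chord is a loop if it pairs two adjacent vertices of the polygon. Spanning paths are considered up to the symmetries of the graph and chord diagrams up to rotations and reflections of the polygon. -}

module Defs where

open import Level using (0ℓ)
open import Data.Nat using (ℕ; zero; suc; _+_; _∸_)
open import Data.Nat.DivMod using (_mod_)
open import Data.Fin using (Fin; toℕ; opposite)
open import Data.Bool using (Bool; not)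
open import Data.Product using (Σ; ∃; _×_; _,_; proj₁)
open import Data.Sum using (_⊎_)
open import Relation.Binary.PropositionalEquality using (_≡_; _≢_)
open import Relation.Binary.Bundles using (Setoid)
open import Relation.Binary.Construct.Closure.Equivalence using (EqClosure)
import Relation.Binary.Construct.Closure.Equivalence as EqC
open import Function.Bundles using (_↔_; _⇔_; Inverse)
open import Function.Definitions using (Injective)

-- The n-Roberts graph
-- Vertices: n antipodal pairs; vertex (i , b) is the facet of the
-- n-cube {x_i = b}; its antipode is (i , not b).

RVertex : ℕ → Set
RVertex n = Fin n × Bool

antipode : ∀ {n} → RVertex n → RVertex n
antipode (i , b) = (i , not b)

RAdj : ∀ {n} → RVertex n → RVertex n → Set
RAdj u v = (u ≢ v) × (u ≢ antipode v)

record RAut (n : ℕ) : Set where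
  field
    perm     : RVertex n ↔ RVertex n
    preserve : ∀ u v → RAdj u v ⇔ RAdj (Inverse.to perm u) (Inverse.to perm v)

record IsAntipodalSpanningPath (n : ℕ) (p : Fin (n + n) → RVertex n) : Set where
  field
    injective  : Injective _≡_ _≡_ p
    surjective : ∀ v → ∃ λ i → p i ≡ v
    consecutive : ∀ i j → toℕ j ≡ suc (toℕ i) → RAdj (p i) (p j)
    endpoints : ∀ i j → toℕ i ≡ 0 → toℕ j ≡ (n + n) ∸ 1 → p j ≡ antipode (p i)

AntipodalSpanningPath : ℕ → Set
AntipodalSpanningPath n = Σ (Fin (n + n) → RVertex n) (IsAntipodalSpanningPath n)

-- One path is mapped onto another by an automorphism (a path is an
-- unoriented object, so its reversal is the same path).
PathMove : ∀ n → AntipodalSpanningPath n → AntipodalSpanningPath n → Set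
PathMove n (p , _) (q , _) = ∃ λ (σ : RAut n) →
    (∀ i → Inverse.to (RAut.perm σ) (p i) ≡ q i)
  ⊎ (∀ i → Inverse.to (RAut.perm σ) (p i) ≡ q (opposite i))

PathSetoid : ℕ → Setoid 0ℓ 0ℓ
PathSetoid n = EqC.setoid (PathMove n)

-- Chord diagrams of a 2n-gon, vertices Fin (n + n) in cyclic order.
-- A chord diagram (perfect matching) is a fixed-point-free involution m:
-- the chords are the pairs {i , m i}.

rot : ∀ {N} → Fin N → Fin N
rot {suc N} i = suc (toℕ i) mod (suc N)

refl' : ∀ {N} → Fin N → Fin N
refl' = opposite

record IsChordDiagram (N : ℕ) (m : Fin N → Fin N) : Set where
  field
    involution : ∀ i → m (m i) ≡ i
    noFixed    : ∀ i → m i ≢ i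

-- the chord {i , m i} is a loop: it joins two adjacent polygon vertices
IsLoop : ∀ {N} → (Fin N → Fin N) → Fin N → Set
IsLoop m i = (m i ≡ rot i) ⊎ (i ≡ rot (m i))

ExactlyOneLoop : ∀ {N} → (Fin N → Fin N) → Set
ExactlyOneLoop m = ∃ λ i → IsLoop m i × (∀ j → IsLoop m j → (j ≡ i) ⊎ (j ≡ m i))

OneLoopChordDiagram : ℕ → Set
OneLoopChordDiagram n =
  Σ (Fin (n + n) → Fin (n + n)) λ m → IsChordDiagram (n + n) m × ExactlyOneLoop m

ChordMove : ∀ n → OneLoopChordDiagram n → OneLoopChordDiagram n → Set
ChordMove n (m , _) (m' , _) =
    (∀ i → m' (rot i) ≡ rot (m i))
  ⊎ (∀ i → m' (refl' i) ≡ refl' (m i))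

-- Chord diagrams up to rotations and reflections (dihedral orbits =
-- equivalence closure of the generator moves).
ChordSetoid : ℕ → Setoid 0ℓ 0ℓ
ChordSetoid n = EqC.setoid (ChordMove n)

module Submission where

-- A spanning path p of the n-Roberts graph with antipodal endpoints, read as
-- a sequence of its 2n vertices, determines a chord diagram of the 2n-gon:
-- position i is matched with the position of the antipode of p i.  The
-- antipodal endpoints give the loop {2n-1 , 0}, and since consecutive vertices
-- of p are adjacent (hence not antipodal) it is the only loop.  We prove that
-- this map is a bijection between the two sets of orbits.
--   * Automorphisms commute with the antipode, so moves of paths become
--     moves of diagrams; conversely paths with equal (or mirrored) diagrams
--     are related by the automorphism Q ∘ P⁻¹ (or Q ∘ reflection ∘ P⁻¹).
--   * For n ≥ 2 a one-loop diagram has a unique loop start s (with m s = s+1);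
--     rotating s to the last vertex gives a normal form, invariant under
--     rotations and conjugated by reflections.
--   * Every normal diagram is the diagram of a path: label the chords by the
--     rank of their smaller endpoint and send position i to the facet
--     (label of its chord , whether i is that smaller endpoint).

open import Defs
open import Data.Nat using (ℕ; zero; suc; _+_; _*_; _∸_; _≤_; _<_; z≤n; s≤s; _%_; _<?_; ⌊_/2⌋)
open import Data.Nat.Properties
open import Data.Nat.DivMod using (_mod_; %-distribˡ-+; m%n%n≡m%n; [m+kn]%n≡m%n; [m+n]%n≡m%n; m<n⇒m%n≡m; n%n≡0)
open import Data.Fin using (Fin; toℕ; fromℕ; fromℕ<; opposite; join; splitAt; punchOut) renaming (zero to fzero; suc to fsuc)
open import Data.Fin.Properties using (toℕ-injective; toℕ<n; toℕ-fromℕ; toℕ-fromℕ<; fromℕ<-cong; opposite-prop; opposite-involutive; splitAt-join; injective⇒≤; punchOut-injective; any?) renaming (_≟_ to _≟F_)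
open import Data.Fin.Permutation using (permutation)
open import Data.Bool using (Bool; true; false; not; if_then_else_)
open import Data.Bool.Properties using (not-involutive) renaming (_≟_ to _≟B_)
open import Data.Empty using (⊥-elim)
open import Data.Product using (Σ; ∃; _,_; proj₁; proj₂)
open import Data.Product.Properties using (≡-dec)
open import Data.Sum using (_⊎_; inj₁; inj₂)
open import Data.Sum.Properties using (inj₁-injective; inj₂-injective)
open import Function.Base using (_∘_)
open import Function.Bundles using (Bijection; Inverse; Equivalence; _⇔_; mk⇔; mk↔ₛ′)
open import Relation.Nullary using (¬_; yes; no; does)
open import Relation.Nullary.Decidable using (dec-true; dec-false)
open import Relation.Binary.PropositionalEquality
open import Relation.Binary.Definitions using (DecidableEquality; tri<; tri≈; tri>)
open import Relation.Binary.Bundles using (Setoid)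
open import Relation.Binary.Construct.Closure.Equivalence using (EqClosure)
import Relation.Binary.Construct.Closure.Equivalence as EqC
open import Relation.Binary.Construct.Closure.ReflexiveTransitive using (ε; _◅_; _◅◅_)
open import Relation.Binary.Construct.Closure.Symmetric using (fwd; bwd)
open import Algebra.Properties.CommutativeMonoid.Sum +-0-commutativeMonoid using (sum; sum-permute; ∑-distrib-+; sum-cong-≗)

module Cyclic (M : ℕ) where

  N : ℕ
  N = suc M

  shift : ℕ → Fin N → Fin N
  shift a j = (toℕ j + a) mod N

  toℕ-shift : ∀ a j → toℕ (shift a j) ≡ (toℕ j + a) % N
  toℕ-shift a j = toℕ-fromℕ< _

  %-small : ∀ {x} → x < N → x % N ≡ x
  %-small = m<n⇒m%n≡m

  %-absorbˡ : ∀ x a → (x % N + a) % N ≡ (x + a) % N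
  %-absorbˡ x a = begin
      (x % N + a) % N          ≡⟨ %-distribˡ-+ (x % N) a N ⟩
      (x % N % N + a % N) % N  ≡⟨ cong (λ z → (z + a % N) % N) (m%n%n≡m%n x N) ⟩
      (x % N + a % N) % N      ≡⟨ %-distribˡ-+ x a N ⟨
      (x + a) % N ∎
    where open ≡-Reasoning

  shift-shift : ∀ a b j → shift a (shift b j) ≡ shift (b + a) j
  shift-shift a b j = toℕ-injective (begin
      toℕ (shift a (shift b j))     ≡⟨ toℕ-shift a (shift b j) ⟩
      (toℕ (shift b j) + a) % N     ≡⟨ cong (λ z → (z + a) % N) (toℕ-shift b j) ⟩
      ((toℕ j + b) % N + a) % N     ≡⟨ %-absorbˡ (toℕ j + b) a ⟩
      (toℕ j + b + a) % N           ≡⟨ cong (_% N) (+-assoc (toℕ j) b a) ⟩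
      (toℕ j + (b + a)) % N         ≡⟨ toℕ-shift (b + a) j ⟨
      toℕ (shift (b + a) j) ∎)
    where open ≡-Reasoning

  shift-comm : ∀ a b j → shift a (shift b j) ≡ shift b (shift a j)
  shift-comm a b j = trans (shift-shift a b j) (trans (cong (λ z → shift z j) (+-comm b a)) (sym (shift-shift b a j)))

  shift-period : ∀ k j → shift (k * N) j ≡ j
  shift-period k j = toℕ-injective (trans (toℕ-shift (k * N) j) (trans ([m+kn]%n≡m%n (toℕ j) k N) (%-small (toℕ<n j))))

  shift-zero : ∀ j → shift 0 j ≡ j
  shift-zero = shift-period 0

  shift-N : ∀ j → shift N j ≡ j
  shift-N j = trans (cong (λ z → shift z j) (sym (*-identityˡ N))) (shift-period 1 j)

  shift-mod : ∀ a x → shift (N + a) x ≡ shift a x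
  shift-mod a x = trans (sym (shift-shift a N x)) (cong (shift a) (shift-N x))

  shift-undo : ∀ a j → shift (a * M) (shift a j) ≡ j
  shift-undo a j = trans (shift-shift (a * M) a j) (trans (cong (λ z → shift z j) (sym (*-suc a M))) (shift-period a j))

  shift-reach : ∀ x j → shift (toℕ j + toℕ x * M) x ≡ j
  shift-reach x j = toℕ-injective (begin
      toℕ (shift (toℕ j + toℕ x * M) x)     ≡⟨ toℕ-shift _ x ⟩
      (toℕ x + (toℕ j + toℕ x * M)) % N     ≡⟨ cong (_% N) (regroup (toℕ x) (toℕ j)) ⟩
      (toℕ j + toℕ x * N) % N               ≡⟨ [m+kn]%n≡m%n (toℕ j) (toℕ x) N ⟩
      toℕ j % N                             ≡⟨ %-small (toℕ<n j) ⟩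
      toℕ j ∎)
    where
    open ≡-Reasoning
    regroup : ∀ x j → x + (j + x * M) ≡ j + x * N
    regroup x j = begin
      x + (j + x * M)   ≡⟨ +-assoc x j _ ⟨
      x + j + x * M     ≡⟨ cong (_+ x * M) (+-comm x j) ⟩
      j + x + x * M     ≡⟨ +-assoc j x _ ⟩
      j + (x + x * M)   ≡⟨ cong (j +_) (*-suc x M) ⟨
      j + x * N ∎

  -- shifts commute and act transitively, so two shifts that agree at one
  -- point agree everywhere
  shift-determined : ∀ a b x → shift a x ≡ shift b x → ∀ j → shift a j ≡ shift b j
  shift-determined a b x e j = begin
      shift a j               ≡⟨ cong (shift a) (shift-reach x j) ⟨
      shift a (shift c x)     ≡⟨ shift-comm a c x ⟩
      shift c (shift a x)     ≡⟨ cong (shift c) e ⟩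
      shift c (shift b x)     ≡⟨ shift-comm c b x ⟩
      shift b (shift c x)     ≡⟨ cong (shift b) (shift-reach x j) ⟩
      shift b j ∎
    where
    open ≡-Reasoning
    c : ℕ
    c = toℕ j + toℕ x * M

  rot≡shift1 : ∀ j → rot j ≡ shift 1 j
  rot≡shift1 j = cong (_mod N) (+-comm 1 (toℕ j))

  toℕ-rot : ∀ (j : Fin N) → toℕ (rot j) ≡ suc (toℕ j) % N
  toℕ-rot j = toℕ-fromℕ< _

  rot-shift : ∀ a j → rot (shift a j) ≡ shift a (rot j)
  rot-shift a j = trans (rot≡shift1 (shift a j)) (trans (shift-comm 1 a j) (cong (shift a) (sym (rot≡shift1 j))))

  shiftM-rot : ∀ x → shift M (rot x) ≡ x
  shiftM-rot x = trans (cong (shift M) (rot≡shift1 x)) (trans (shift-shift M 1 x) (shift-N x))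

  rot-shiftM : ∀ x → rot (shift M x) ≡ x
  rot-shiftM x = trans (rot-shift M x) (shiftM-rot x)

  rot-injective : ∀ {a b} → rot a ≡ rot b → a ≡ b
  rot-injective {a} {b} e = trans (sym (shiftM-rot a)) (trans (cong (shift M) e) (shiftM-rot b))

  rot²-nofix : 2 ≤ M → ∀ s → rot (rot s) ≢ s
  rot²-nofix 2≤M s e = 0≢1+n (trans (sym (cong toℕ (shift-zero fzero))) (trans (cong toℕ (sym two≡zero)) two))
    where
    rot² : ∀ j → rot (rot j) ≡ shift 2 j
    rot² j = trans (rot≡shift1 (rot j)) (trans (cong (shift 1) (rot≡shift1 j)) (shift-shift 1 1 j))
    two≡zero : shift 2 fzero ≡ shift 0 fzero
    two≡zero = shift-determined 2 0 s (trans (sym (rot² s)) (trans e (sym (shift-zero s)))) fzero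
    two : toℕ (shift 2 fzero) ≡ 2
    two = trans (toℕ-shift 2 fzero) (%-small (s≤s 2≤M))

  last : Fin N
  last = fromℕ M

  toℕ-last : toℕ last ≡ M
  toℕ-last = toℕ-fromℕ M

  rot-last : rot last ≡ fzero
  rot-last = toℕ-injective (trans (toℕ-rot last) (trans (cong (λ z → suc z % N) toℕ-last) (n%n≡0 N)))

  toℕ-rot-≢last : ∀ x → x ≢ last → toℕ (rot x) ≡ suc (toℕ x)
  toℕ-rot-≢last x x≢last = trans (toℕ-rot x) (%-small (s≤s x<M))
    where
    x<M : toℕ x < M
    x<M = ≤∧≢⇒< (≤-pred (toℕ<n x)) (λ e → x≢last (toℕ-injective (trans e (sym toℕ-last))))

  successor-is-rot : ∀ i j → toℕ j ≡ suc (toℕ i) → j ≡ rot i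
  successor-is-rot i j e = toℕ-injective (trans e (trans (sym (%-small (subst (_< N) e (toℕ<n j)))) (sym (toℕ-rot i))))

  toLast fromLast : Fin N → Fin N → Fin N
  toLast s = shift (M ∸ toℕ s)
  fromLast s = shift (suc (toℕ s))

  toLast-self : ∀ s → toLast s s ≡ last
  toLast-self s = toℕ-injective (begin
      toℕ (toLast s s)               ≡⟨ toℕ-shift _ s ⟩
      (toℕ s + (M ∸ toℕ s)) % N      ≡⟨ cong (_% N) (m+[n∸m]≡n (≤-pred (toℕ<n s))) ⟩
      M % N                          ≡⟨ %-small ≤-refl ⟩
      M                              ≡⟨ toℕ-last ⟨
      toℕ last ∎)
    where open ≡-Reasoning

  fromLast-self : ∀ s → fromLast s last ≡ s
  fromLast-self s = toℕ-injective (begin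
      toℕ (fromLast s last)          ≡⟨ toℕ-shift _ last ⟩
      (toℕ last + suc (toℕ s)) % N   ≡⟨ cong (λ z → (z + suc (toℕ s)) % N) toℕ-last ⟩
      (M + suc (toℕ s)) % N          ≡⟨ cong (_% N) (trans (+-suc M (toℕ s)) (+-comm N (toℕ s))) ⟩
      (toℕ s + N) % N                ≡⟨ [m+n]%n≡m%n (toℕ s) N ⟩
      toℕ s % N                      ≡⟨ %-small (toℕ<n s) ⟩
      toℕ s ∎)
    where open ≡-Reasoning

  toLast-fromLast : ∀ s j → toLast s (fromLast s j) ≡ j
  toLast-fromLast s j = trans (shift-shift _ _ j) (trans (cong (λ z → shift (suc z) j) (m+[n∸m]≡n (≤-pred (toℕ<n s)))) (shift-N j))

  fromLast-toLast : ∀ s j → fromLast s (toLast s j) ≡ j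
  fromLast-toLast s j = trans (shift-comm _ _ j) (toLast-fromLast s j)

  toLast-last : ∀ j → toLast last j ≡ j
  toLast-last j = trans (cong (λ a → shift (M ∸ a) j) toℕ-last) (trans (cong (λ a → shift a j) (n∸n≡0 M)) (shift-zero j))

  fromLast-last : ∀ j → fromLast last j ≡ j
  fromLast-last j = trans (cong (λ a → shift (suc a) j) toℕ-last) (shift-N j)

  toℕ-opposite : ∀ j → toℕ (opposite j) ≡ M ∸ toℕ j
  toℕ-opposite j = opposite-prop {N} j

  opposite-opposite : ∀ j → opposite (opposite j) ≡ j
  opposite-opposite = opposite-involutive {N}

  opposite-zero : opposite fzero ≡ last
  opposite-zero = toℕ-injective (trans (toℕ-opposite fzero) (sym toℕ-last))

  opposite-last : opposite last ≡ fzero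
  opposite-last = trans (cong opposite (sym opposite-zero)) (opposite-opposite fzero)

  opposite-rot-opposite : ∀ y → opposite (rot (opposite y)) ≡ shift M y
  opposite-rot-opposite y = toℕ-injective (begin
      toℕ (opposite (rot (opposite y)))   ≡⟨ toℕ-opposite (rot (opposite y)) ⟩
      M ∸ toℕ (rot (opposite y))           ≡⟨ cong (M ∸_) (toℕ-rot (opposite y)) ⟩
      M ∸ (suc (toℕ (opposite y)) % N)     ≡⟨ cong (λ z → M ∸ (suc z % N)) (toℕ-opposite y) ⟩
      M ∸ (suc (M ∸ toℕ y) % N)            ≡⟨ arith (toℕ y) (≤-pred (toℕ<n y)) ⟩
      (toℕ y + M) % N                      ≡⟨ toℕ-shift M y ⟨
      toℕ (shift M y) ∎)
    where
    open ≡-Reasoning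
    arith : ∀ z → z ≤ M → M ∸ (suc (M ∸ z) % N) ≡ (z + M) % N
    arith zero _ = trans (cong (M ∸_) (n%n≡0 N)) (sym (%-small ≤-refl))
    arith (suc z) z<M = begin
        M ∸ (suc (M ∸ suc z) % N)                ≡⟨ cong (M ∸_) (%-small (s≤s (≤-trans (m≤m+n _ z) (≤-reflexive split)))) ⟩
        M ∸ suc (M ∸ suc z)                      ≡⟨ cong (_∸ suc (M ∸ suc z)) split ⟨
        (suc (M ∸ suc z) + z) ∸ suc (M ∸ suc z)  ≡⟨ m+n∸m≡n (suc (M ∸ suc z)) z ⟩
        z                                        ≡⟨ %-small (≤-trans z<M (n≤1+n M)) ⟨
        z % N                                    ≡⟨ [m+n]%n≡m%n z N ⟨
        (z + N) % N                              ≡⟨ cong (_% N) (+-suc z M) ⟩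
        (suc z + M) % N ∎
      where
      split : suc (M ∸ suc z) + z ≡ M
      split = trans (sym (+-suc (M ∸ suc z) z)) (m∸n+n≡m z<M)

  rot-opposite-rot : ∀ x → rot (opposite (rot x)) ≡ opposite x
  rot-opposite-rot x = trans (sym (opposite-opposite _)) (cong opposite (trans (opposite-rot-opposite (rot x)) (shiftM-rot x)))

  opposite-shift-opposite : ∀ a y → opposite (shift a (opposite y)) ≡ shift (a * M) y
  opposite-shift-opposite zero y = trans (cong opposite (shift-zero (opposite y))) (trans (opposite-opposite y) (sym (shift-zero y)))
  opposite-shift-opposite (suc a) y = begin
      opposite (shift (suc a) (opposite y))               ≡⟨ cong (λ z → opposite (shift z (opposite y))) (+-comm 1 a) ⟩
      opposite (shift (a + 1) (opposite y))               ≡⟨ cong opposite (shift-shift 1 a (opposite y)) ⟨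
      opposite (shift 1 (shift a (opposite y)))           ≡⟨ cong opposite (rot≡shift1 _) ⟨
      opposite (rot (shift a (opposite y)))               ≡⟨ cong (λ z → opposite (rot z)) (opposite-opposite _) ⟨
      opposite (rot (opposite (opposite (shift a (opposite y))))) ≡⟨ opposite-rot-opposite (opposite (shift a (opposite y))) ⟩
      shift M (opposite (shift a (opposite y)))           ≡⟨ cong (shift M) (opposite-shift-opposite a y) ⟩
      shift M (shift (a * M) y)                           ≡⟨ shift-shift M (a * M) y ⟩
      shift (a * M + M) y                                 ≡⟨ cong (λ z → shift z y) (+-comm (a * M) M) ⟩
      shift (suc a * M) y ∎
    where open ≡-Reasoning

  -- Moving the normalising rotations along a rotation or a reflection.
  -- Both sides are shifts, so by shift-determined it suffices to compare them
  -- at one point.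
  fromLast-rot : ∀ s j → fromLast (rot s) j ≡ rot (fromLast s j)
  fromLast-rot s j = trans (shift-determined _ _ last agree j) (sym (rot-as-shift _ j))
    where
    rot-as-shift : ∀ a j → rot (shift a j) ≡ shift (a + 1) j
    rot-as-shift a j = trans (rot≡shift1 _) (shift-shift 1 a j)
    agree : fromLast (rot s) last ≡ shift (suc (toℕ s) + 1) last
    agree = trans (fromLast-self (rot s)) (trans (cong rot (sym (fromLast-self s))) (rot-as-shift _ last))

  toLast-rot : ∀ s x → toLast (rot s) (rot x) ≡ toLast s x
  toLast-rot s x = trans (cong (toLast (rot s)) (rot≡shift1 x)) (trans (shift-shift _ 1 x) (shift-determined _ _ s agree x))
    where
    agree : shift (1 + (M ∸ toℕ (rot s))) s ≡ toLast s s
    agree = begin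
        shift (1 + (M ∸ toℕ (rot s))) s   ≡⟨ shift-shift _ 1 s ⟨
        toLast (rot s) (shift 1 s)        ≡⟨ cong (toLast (rot s)) (rot≡shift1 s) ⟨
        toLast (rot s) (rot s)            ≡⟨ toLast-self (rot s) ⟩
        last                              ≡⟨ toLast-self s ⟨
        toLast s s ∎
      where open ≡-Reasoning

  fromLast-opposite : ∀ {s s′} → rot s′ ≡ opposite s → ∀ j → opposite (fromLast s′ j) ≡ fromLast s (opposite j)
  fromLast-opposite {s} {s′} rs′ j = begin
      opposite (fromLast s′ j)                          ≡⟨ cong (opposite ∘ fromLast s′) (opposite-opposite j) ⟨
      opposite (fromLast s′ (opposite (opposite j)))    ≡⟨ opposite-shift-opposite _ (opposite j) ⟩
      shift (suc (toℕ s′) * M) (opposite j)             ≡⟨ shift-determined _ _ last agree (opposite j) ⟩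
      fromLast s (opposite j) ∎
    where
    open ≡-Reasoning
    agree : shift (suc (toℕ s′) * M) last ≡ fromLast s last
    agree = begin
        shift (suc (toℕ s′) * M) last              ≡⟨ opposite-shift-opposite _ last ⟨
        opposite (fromLast s′ (opposite last))     ≡⟨ cong (opposite ∘ fromLast s′) opposite-last ⟩
        opposite (rot s′)                          ≡⟨ cong opposite rs′ ⟩
        opposite (opposite s)                      ≡⟨ opposite-opposite s ⟩
        s                                          ≡⟨ fromLast-self s ⟨
        fromLast s last ∎

  toLast-opposite : ∀ {s s′} → rot s′ ≡ opposite s → ∀ z → toLast s′ (opposite z) ≡ opposite (toLast s z)
  toLast-opposite {s} {s′} rs′ z = begin
      toLast s′ (opposite z)                           ≡⟨ opposite-opposite _ ⟨
      opposite (opposite (toLast s′ (opposite z)))     ≡⟨ cong opposite (opposite-shift-opposite _ z) ⟩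
      opposite (shift ((M ∸ toℕ s′) * M) z)            ≡⟨ cong opposite (shift-determined _ _ s agree z) ⟩
      opposite (toLast s z) ∎
    where
    open ≡-Reasoning
    agree : shift ((M ∸ toℕ s′) * M) s ≡ toLast s s
    agree = begin
        shift ((M ∸ toℕ s′) * M) s               ≡⟨ opposite-shift-opposite _ s ⟨
        opposite (toLast s′ (opposite s))        ≡⟨ cong (opposite ∘ toLast s′) rs′ ⟨
        opposite (toLast s′ (rot s′))            ≡⟨ cong opposite (rot-shift _ s′) ⟨
        opposite (rot (toLast s′ s′))            ≡⟨ cong (opposite ∘ rot) (toLast-self s′) ⟩
        opposite (rot last)                      ≡⟨ cong opposite rot-last ⟩
        opposite fzero                           ≡⟨ opposite-zero ⟩
        last                                     ≡⟨ toLast-self s ⟨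
        toLast s s ∎

closure-map : ∀ {A B : Set} {R : A → A → Set} {S : B → B → Set} (f : A → B) →
              (∀ x y → R x y → EqClosure S (f x) (f y)) →
              ∀ {x y} → EqClosure R x y → EqClosure S (f x) (f y)
closure-map f move ε = ε
closure-map f move (_◅_ {i = x} {j = y} (fwd r) rest) = move x y r ◅◅ closure-map f move rest
closure-map {S = S} f move (_◅_ {i = x} {j = y} (bwd r) rest) = EqC.symmetric S (move y x r) ◅◅ closure-map f move rest

sum-mono : ∀ {L} (g h : Fin L → ℕ) → (∀ i → g i ≤ h i) → sum g ≤ sum h
sum-mono {zero} g h g≤h = z≤n
sum-mono {suc L} g h g≤h = +-mono-≤ (g≤h fzero) (sum-mono (g ∘ fsuc) (h ∘ fsuc) (g≤h ∘ fsuc))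

sum-strict : ∀ {L} (g h : Fin L → ℕ) → (∀ i → g i ≤ h i) → ∀ x → g x < h x → sum g < sum h
sum-strict {suc L} g h g≤h fzero lt = +-mono-<-≤ lt (sum-mono (g ∘ fsuc) (h ∘ fsuc) (g≤h ∘ fsuc))
sum-strict {suc L} g h g≤h (fsuc x) lt = +-mono-≤-< (g≤h fzero) (sum-strict (g ∘ fsuc) (h ∘ fsuc) (g≤h ∘ fsuc) x lt)

sum-ones : ∀ L → sum {L} (λ _ → 1) ≡ L
sum-ones zero = refl
sum-ones (suc L) = cong suc (sum-ones L)

sum-half : ∀ {L} (c : Fin L → ℕ) (f : Fin L → Fin L) → (∀ i → f (f i) ≡ i) →
           (∀ i → c i + c (f i) ≡ 1) → sum c + sum c ≡ L
sum-half {L} c f f² c+cf = begin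
    sum c + sum c                  ≡⟨ cong (sum c +_) (sum-permute c (permutation f f f² f²)) ⟩
    sum c + sum (c ∘ f)            ≡⟨ ∑-distrib-+ c (c ∘ f) ⟨
    sum (λ i → c i + c (f i))      ≡⟨ sum-cong-≗ c+cf ⟩
    sum {L} (λ _ → 1)              ≡⟨ sum-ones L ⟩
    L ∎
  where open ≡-Reasoning

half-injective : ∀ {a b} → a + a ≡ b + b → a ≡ b
half-injective {a} {b} e = trans (n≡⌊n+n/2⌋ a) (trans (cong ⌊_/2⌋ e) (sym (n≡⌊n+n/2⌋ b)))

injection-onto : ∀ {m} {A : Set} → DecidableEquality A →
                 (e : A → Fin (suc m)) → (∀ {u v} → e u ≡ e v → u ≡ v) →
                 (f : Fin (suc m) → A) → (∀ {i j} → f i ≡ f j → i ≡ j) →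
                 ∀ a → ∃ λ i → f i ≡ a
injection-onto {m} _≟_ e e-inj f f-inj a with any? (λ i → f i ≟ a)
... | yes hit = hit
... | no miss = ⊥-elim (<-irrefl refl (injective⇒≤ {f = squeeze} squeeze-inj))
  where
  avoid : ∀ i → e a ≢ e (f i)
  avoid i eq = miss (i , sym (e-inj eq))
  -- Fin (suc m) → Fin m, skipping the code of the missed value a
  squeeze : Fin (suc m) → Fin m
  squeeze i = punchOut (avoid i)
  squeeze-inj : ∀ {i j} → squeeze i ≡ squeeze j → i ≡ j
  squeeze-inj eq = f-inj (e-inj (punchOut-injective (avoid _) (avoid _) eq))

antipode-involutive : ∀ {n} (v : RVertex n) → antipode (antipode v) ≡ v
antipode-involutive (i , b) = cong (i ,_) (not-involutive b)

antipode-nofix : ∀ {n} (v : RVertex n) → v ≢ antipode v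
antipode-nofix (i , false) ()
antipode-nofix (i , true) ()

_≟V_ : ∀ {n} → DecidableEquality (RVertex n)
_≟V_ = ≡-dec _≟F_ _≟B_

join-injective : ∀ {n} {x y : Fin n ⊎ Fin n} → join n n x ≡ join n n y → x ≡ y
join-injective {n} {x} {y} e = trans (sym (splitAt-join n n x)) (trans (cong (splitAt n) e) (splitAt-join n n y))

code : ∀ {n} → RVertex n → Fin (n + n)
code {n} (c , false) = join n n (inj₁ c)
code {n} (c , true) = join n n (inj₂ c)

code-injective : ∀ {n} {u v : RVertex n} → code u ≡ code v → u ≡ v
code-injective {_} {c , false} {d , false} e = cong (_, false) (inj₁-injective (join-injective {_} {inj₁ c} {inj₁ d} e))
code-injective {_} {c , true} {d , true} e = cong (_, true) (inj₂-injective (join-injective {_} {inj₂ c} {inj₂ d} e))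
code-injective {_} {c , false} {d , true} e with () ← join-injective {_} {inj₁ c} {inj₂ d} e
code-injective {_} {c , true} {d , false} e with () ← join-injective {_} {inj₂ c} {inj₁ d} e

antipodal-preserves-adjacency : ∀ {n} (σ : RVertex n → RVertex n) →
    (∀ {u v} → σ u ≡ σ v → u ≡ v) → (∀ v → σ (antipode v) ≡ antipode (σ v)) →
    ∀ u v → RAdj u v ⇔ RAdj (σ u) (σ v)
antipodal-preserves-adjacency σ σ-inj σ-ant u v = mk⇔
  (λ { (u≢v , u≢v̄) → (λ e → u≢v (σ-inj e)) , (λ e → u≢v̄ (σ-inj (trans e (sym (σ-ant v))))) })
  (λ { (σu≢σv , σu≢σv̄) → (λ e → σu≢σv (cong σ e)) , (λ e → σu≢σv̄ (trans (cong σ e) (σ-ant v))) })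

automorphism-injective : ∀ {n} (σ : RAut n) {u v} →
    Inverse.to (RAut.perm σ) u ≡ Inverse.to (RAut.perm σ) v → u ≡ v
automorphism-injective σ {u} {v} e = trans (sym (strictlyInverseʳ u)) (trans (cong from e) (strictlyInverseʳ v))
  where open Inverse (RAut.perm σ)

-- every automorphism commutes with the antipode, since antipode u is the
-- only vertex other than u that is not adjacent to u
automorphism-antipode : ∀ {n} (σ : RAut n) u →
    Inverse.to (RAut.perm σ) (antipode u) ≡ antipode (Inverse.to (RAut.perm σ) u)
automorphism-antipode σ u with to u ≟V antipode (to (antipode u))
  where open Inverse (RAut.perm σ)
... | yes e = trans (sym (antipode-involutive _)) (cong antipode (sym e))
... | no ne = ⊥-elim (not-adjacent (Equivalence.from (RAut.preserve σ u (antipode u))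
                ((λ e → antipode-nofix u (automorphism-injective σ e)) , ne)))
  where
  open Inverse (RAut.perm σ)
  not-adjacent : ¬ RAdj u (antipode u)
  not-adjacent (_ , not-antipodal) = not-antipodal (sym (antipode-involutive u))

-- From now on n = suc k, so that the 2n positions of a path and the 2n
-- vertices of the polygon are Fin N with N = n + n = suc M.
module Roberts (k : ℕ) where

  n M : ℕ
  n = suc k
  M = k + suc k

  open Cyclic M public

  Path : Set
  Path = AntipodalSpanningPath n

  Diagram : Set
  Diagram = OneLoopChordDiagram n

  chords : Diagram → Fin N → Fin N
  chords = proj₁

  _≈P_ : Path → Path → Set
  _≈P_ = EqClosure (PathMove n)

  _≈D_ : Diagram → Diagram → Set
  _≈D_ = EqClosure (ChordMove n)

  module _ (P : Path) where
    open IsAntipodalSpanningPath (proj₂ P)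

    private
      p : Fin N → RVertex n
      p = proj₁ P

    position : RVertex n → Fin N
    position v = proj₁ (surjective v)

    at-position : ∀ v → p (position v) ≡ v
    at-position v = proj₂ (surjective v)

    position-at : ∀ i → position (p i) ≡ i
    position-at i = injective (at-position (p i))

    partner : Fin N → Fin N
    partner i = position (antipode (p i))

    at-partner : ∀ i → p (partner i) ≡ antipode (p i)
    at-partner i = at-position _

    partner-involutive : ∀ i → partner (partner i) ≡ i
    partner-involutive i = injective (trans (at-partner (partner i)) (trans (cong antipode (at-partner i)) (antipode-involutive (p i))))

    partner-nofix : ∀ i → partner i ≢ i
    partner-nofix i e = antipode-nofix (p i) (sym (trans (sym (at-partner i)) (cong p e)))

    partner-last : partner last ≡ fzero
    partner-last = injective (trans (at-partner last)
      (trans (cong antipode (endpoints fzero last refl toℕ-last)) (antipode-involutive (p fzero))))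

    -- consecutive vertices of the path are never antipodal, so no other loop
    only-loop : ∀ j → IsLoop partner j → (j ≡ last) ⊎ (j ≡ partner last)
    only-loop j (inj₁ e) with j ≟F last
    ... | yes j≡last = inj₁ j≡last
    ... | no j≢last = ⊥-elim (proj₂ (consecutive j (rot j) (toℕ-rot-≢last j j≢last))
          (sym (trans (cong antipode (trans (cong p (sym e)) (at-partner j))) (antipode-involutive (p j)))))
    only-loop j (inj₂ e) with partner j ≟F last
    ... | yes pj≡last = inj₂ (trans e (trans (cong rot pj≡last) (trans rot-last (sym partner-last))))
    ... | no pj≢last = ⊥-elim (proj₂ (consecutive (partner j) j (trans (cong toℕ e) (toℕ-rot-≢last (partner j) pj≢last)))
          (at-partner j))

    pathDiagram : Diagram
    pathDiagram = partner , record { involution = partner-involutive ; noFixed = partner-nofix }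
                , last , inj₁ (trans partner-last (sym rot-last)) , only-loop

  -- If an involution τ of the positions carries the diagram of P onto that of
  -- Q, then v ↦ Q (τ (P⁻¹ v)) commutes with the antipode, hence is an
  -- automorphism; it maps the path P onto the path Q ∘ τ.
  module _ (P Q : Path) (τ : Fin N → Fin N) (τ-involutive : ∀ i → τ (τ i) ≡ i)
           (τ-partner : ∀ i → partner Q (τ i) ≡ τ (partner P i)) where

    private
      p q : Fin N → RVertex n
      p = proj₁ P
      q = proj₁ Q
      σ σ⁻¹ : RVertex n → RVertex n
      σ v = q (τ (position P v))
      σ⁻¹ v = p (τ (position Q v))

      σσ⁻¹ : ∀ v → σ (σ⁻¹ v) ≡ v
      σσ⁻¹ v = trans (cong (q ∘ τ) (position-at P _)) (trans (cong q (τ-involutive _)) (at-position Q v))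

      σ⁻¹σ : ∀ v → σ⁻¹ (σ v) ≡ v
      σ⁻¹σ v = trans (cong (p ∘ τ) (position-at Q _)) (trans (cong p (τ-involutive _)) (at-position P v))

      σ-antipode : ∀ v → σ (antipode v) ≡ antipode (σ v)
      σ-antipode v = begin
          q (τ (position P (antipode v)))       ≡⟨ cong (λ z → q (τ (position P (antipode z)))) (at-position P v) ⟨
          q (τ (partner P i))                   ≡⟨ cong q (τ-partner i) ⟨
          q (partner Q (τ i))                   ≡⟨ at-partner Q (τ i) ⟩
          antipode (q (τ i)) ∎
        where
        open ≡-Reasoning
        i : Fin N
        i = position P v

    transport-automorphism : RAut n
    transport-automorphism = record
      { perm = mk↔ₛ′ σ σ⁻¹ σσ⁻¹ σ⁻¹σ
      ; preserve = antipodal-preserves-adjacency σ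
          (λ {u} {v} e → trans (sym (σ⁻¹σ u)) (trans (cong σ⁻¹ e) (σ⁻¹σ v))) σ-antipode
      }

    transport-automorphism-maps : ∀ i → Inverse.to (RAut.perm transport-automorphism) (p i) ≡ q (τ i)
    transport-automorphism-maps i = cong (q ∘ τ) (position-at P i)

  -- Conversely an automorphism carrying P onto Q ∘ τ carries the diagram of
  -- P onto that of Q along τ, because it commutes with the antipode.
  automorphism-partner : ∀ P Q (σ : RAut n) (τ : Fin N → Fin N) →
      (∀ i → Inverse.to (RAut.perm σ) (proj₁ P i) ≡ proj₁ Q (τ i)) →
      ∀ i → partner Q (τ i) ≡ τ (partner P i)
  automorphism-partner P Q σ τ e i = IsAntipodalSpanningPath.injective (proj₂ Q) (begin
      proj₁ Q (partner Q (τ i))    ≡⟨ at-partner Q (τ i) ⟩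
      antipode (proj₁ Q (τ i))     ≡⟨ cong antipode (e i) ⟨
      antipode (s (proj₁ P i))     ≡⟨ automorphism-antipode σ (proj₁ P i) ⟨
      s (antipode (proj₁ P i))     ≡⟨ cong s (at-partner P i) ⟨
      s (proj₁ P (partner P i))    ≡⟨ e (partner P i) ⟩
      proj₁ Q (τ (partner P i)) ∎)
    where
    open ≡-Reasoning
    s : RVertex n → RVertex n
    s = Inverse.to (RAut.perm σ)

  same-diagram⇒≈P : (P Q : Path) → (∀ i → partner Q i ≡ partner P i) → P ≈P Q
  same-diagram⇒≈P P Q e = fwd (transport-automorphism P Q (λ i → i) (λ _ → refl) e
                              , inj₁ (transport-automorphism-maps P Q (λ i → i) (λ _ → refl) e)) ◅ ε

  mirror-diagram⇒≈P : (P Q : Path) → (∀ i → partner Q (opposite i) ≡ opposite (partner P i)) → P ≈P Q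
  mirror-diagram⇒≈P P Q e = fwd (transport-automorphism P Q opposite opposite-opposite e
                                , inj₂ (transport-automorphism-maps P Q opposite opposite-opposite e)) ◅ ε

  rotateDiagram : Diagram → Diagram
  rotateDiagram (m , cd , i , loop , unique) =
    m′ , record { involution = m′-involutive ; noFixed = m′-nofix } , rot i , loop′ loop , unique′
    where
    open IsChordDiagram cd
    m′ : Fin N → Fin N
    m′ j = rot (m (shift M j))
    m′-rot : ∀ j → m′ (rot j) ≡ rot (m j)
    m′-rot j = cong (rot ∘ m) (shiftM-rot j)
    m′-involutive : ∀ j → m′ (m′ j) ≡ j
    m′-involutive j = trans (m′-rot _) (trans (cong rot (involution _)) (rot-shiftM j))
    m′-nofix : ∀ j → m′ j ≢ j
    m′-nofix j e = noFixed (shift M j) (rot-injective (trans e (sym (rot-shiftM j))))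
    loop′ : ∀ {i} → IsLoop m i → IsLoop m′ (rot i)
    loop′ {i} (inj₁ e) = inj₁ (trans (m′-rot i) (cong rot e))
    loop′ {i} (inj₂ e) = inj₂ (trans (cong rot e) (cong rot (sym (m′-rot i))))
    loop-back : ∀ {j} → IsLoop m′ j → IsLoop m (shift M j)
    loop-back {j} (inj₁ e) = inj₁ (rot-injective (trans e (cong rot (sym (rot-shiftM j)))))
    loop-back {j} (inj₂ e) = inj₂ (rot-injective (trans (rot-shiftM j) e))
    unique′ : ∀ j → IsLoop m′ j → (j ≡ rot i) ⊎ (j ≡ m′ (rot i))
    unique′ j l with unique (shift M j) (loop-back l)
    ... | inj₁ e = inj₁ (trans (sym (rot-shiftM j)) (cong rot e))
    ... | inj₂ e = inj₂ (trans (sym (rot-shiftM j)) (trans (cong rot e) (sym (m′-rot i))))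

  rotations : ℕ → Diagram → Diagram
  rotations zero d = d
  rotations (suc t) d = rotateDiagram (rotations t d)

  chords-rotations : ∀ t d j → chords (rotations t d) j ≡ shift t (chords d (shift (t * M) j))
  chords-rotations zero d j = trans (sym (shift-zero _)) (cong (shift 0 ∘ chords d) (sym (shift-zero j)))
  chords-rotations (suc t) d j = begin
      rot (chords (rotations t d) (shift M j))              ≡⟨ cong rot (chords-rotations t d (shift M j)) ⟩
      rot (shift t (chords d (shift (t * M) (shift M j))))  ≡⟨ cong (rot ∘ shift t ∘ chords d) (shift-shift (t * M) M j) ⟩
      rot (shift t (chords d (shift (suc t * M) j)))        ≡⟨ rot≡shift1 _ ⟩
      shift 1 (shift t (chords d (shift (suc t * M) j)))    ≡⟨ shift-shift 1 t (chords d (shift (suc t * M) j)) ⟩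
      shift (t + 1) (chords d (shift (suc t * M) j))        ≡⟨ cong (λ z → shift z (chords d (shift (suc t * M) j))) (+-comm t 1) ⟩
      shift (suc t) (chords d (shift (suc t * M) j)) ∎
    where open ≡-Reasoning

  rotate-move : ∀ d → ChordMove n d (rotateDiagram d)
  rotate-move d = inj₁ λ i → cong (rot ∘ chords d) (shiftM-rot i)

  ≈D-rotations : ∀ t d → d ≈D rotations t d
  ≈D-rotations zero d = ε
  ≈D-rotations (suc t) d = ≈D-rotations t d ◅◅ (fwd (rotate-move (rotations t d)) ◅ ε)

  -- Without function extensionality a diagram equal to a rotation of d only
  -- pointwise is still reached by moves: the last move can target it directly.
  ≈D-pointwise-rotation : ∀ t d g → (∀ j → chords g j ≡ chords (rotations (suc t) d) j) → d ≈D g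
  ≈D-pointwise-rotation t d g e =
    ≈D-rotations t d ◅◅ (fwd (inj₁ λ i → trans (e (rot i)) (cong (rot ∘ chords (rotations t d)) (shiftM-rot i))) ◅ ε)

  -- in particular pointwise-equal diagrams are equivalent (N rotations)
  ≈D-pointwise : ∀ d g → (∀ j → chords g j ≡ chords d j) → d ≈D g
  ≈D-pointwise d g e = ≈D-pointwise-rotation M d g λ j → begin
      chords g j                                   ≡⟨ e j ⟩
      chords d j                                   ≡⟨ cong (chords d) (shift-period M j) ⟨
      chords d (shift (M * N) j)                   ≡⟨ cong (λ z → chords d (shift z j)) (*-comm M N) ⟩
      chords d (shift (N * M) j)                   ≡⟨ shift-N _ ⟨
      shift N (chords d (shift (N * M) j))         ≡⟨ chords-rotations N d j ⟨
      chords (rotations N d) j ∎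
    where open ≡-Reasoning

  pathDiagram-move : ∀ P Q → PathMove n P Q → pathDiagram P ≈D pathDiagram Q
  pathDiagram-move P Q (σ , inj₁ e) = ≈D-pointwise (pathDiagram P) (pathDiagram Q) (automorphism-partner P Q σ (λ i → i) e)
  pathDiagram-move P Q (σ , inj₂ e) = fwd (inj₂ (automorphism-partner P Q σ opposite e)) ◅ ε

  pathDiagram-cong : ∀ {P Q} → P ≈P Q → pathDiagram P ≈D pathDiagram Q
  pathDiagram-cong = closure-map pathDiagram pathDiagram-move

  -- A chord function is normal when its only loop is {last , 0}, read
  -- without wrap-around: no chord joins i and i + 1.
  record Normal (f : Fin N → Fin N) : Set where
    field
      involutive : ∀ i → f (f i) ≡ i
      nofix      : ∀ i → f i ≢ i
      last↦zero  : f last ≡ fzero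
      no-step    : ∀ i j → toℕ j ≡ suc (toℕ i) → f i ≢ j

  -- Every normal chord function is the diagram of a path: the chords, ordered
  -- by their smaller endpoint (opener), are labelled 0 … n-1 and position i
  -- is sent to the facet (label of its chord , whether i is the opener).
  module PathOfNormal (f : Fin N → Fin N) (normal : Normal f) where
    open Normal normal

    isOpener : Fin N → Bool
    isOpener i = does (toℕ i <? toℕ (f i))

    isOpener-partner : ∀ i → isOpener (f i) ≡ not (isOpener i)
    isOpener-partner i with toℕ i <? toℕ (f i)
    ... | yes i<fi = trans
          (dec-false (toℕ (f i) <? toℕ (f (f i)))
            (λ fi<ffi → <-asym i<fi (subst (λ z → toℕ (f i) < toℕ z) (involutive i) fi<ffi)))
          (cong not (sym (dec-true (toℕ i <? toℕ (f i)) i<fi)))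
    ... | no i≮fi = trans
          (dec-true (toℕ (f i) <? toℕ (f (f i)))
            (subst (λ z → toℕ (f i) < toℕ z) (sym (involutive i))
              (≤∧≢⇒< (≮⇒≥ i≮fi) (λ e → nofix i (toℕ-injective e)))))
          (cong not (sym (dec-false (toℕ i <? toℕ (f i)) i≮fi)))

    count : Bool → ℕ
    count b = if b then 1 else 0

    count-not : ∀ b → count b + count (not b) ≡ 1
    count-not true = refl
    count-not false = refl

    openers : sum (count ∘ isOpener) ≡ n
    openers = half-injective (sum-half (count ∘ isOpener) f involutive
      (λ i → trans (cong (λ b → count (isOpener i) + count b) (isOpener-partner i)) (count-not (isOpener i))))

    countBefore : Fin N → Fin N → ℕ
    countBefore x y = if does (toℕ y <? toℕ x) then count (isOpener y) else 0

    rank : Fin N → ℕ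
    rank x = sum (countBefore x)

    countBefore-≤ : ∀ x y → countBefore x y ≤ count (isOpener y)
    countBefore-≤ x y with toℕ y <? toℕ x
    ... | yes y<x rewrite dec-true (toℕ y <? toℕ x) y<x = ≤-refl
    ... | no y≮x rewrite dec-false (toℕ y <? toℕ x) y≮x = z≤n

    countBefore-mono : ∀ {x x′} → toℕ x < toℕ x′ → ∀ y → countBefore x y ≤ countBefore x′ y
    countBefore-mono {x} {x′} x<x′ y with toℕ y <? toℕ x
    ... | no y≮x rewrite dec-false (toℕ y <? toℕ x) y≮x = z≤n
    ... | yes y<x rewrite dec-true (toℕ y <? toℕ x) y<x | dec-true (toℕ y <? toℕ x′) (<-trans y<x x<x′) = ≤-refl

    countBefore-self : ∀ x → countBefore x x ≡ 0
    countBefore-self x rewrite dec-false (toℕ x <? toℕ x) (<-irrefl refl) = refl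

    opener-counted : ∀ {x x′} → isOpener x ≡ true → toℕ x < toℕ x′ → countBefore x x < countBefore x′ x
    opener-counted {x} {x′} op x<x′ rewrite countBefore-self x | dec-true (toℕ x <? toℕ x′) x<x′ | op = s≤s z≤n

    rank<n : ∀ x → isOpener x ≡ true → rank x < n
    rank<n x op = subst (rank x <_) openers (sum-strict (countBefore x) (count ∘ isOpener) (countBefore-≤ x) x
      (subst₂ _<_ (sym (countBefore-self x)) (cong count (sym op)) (s≤s z≤n)))

    -- ranks strictly increase from an opener onwards, so they separate openers
    rank-strict : ∀ {x x′} → isOpener x ≡ true → toℕ x < toℕ x′ → rank x < rank x′
    rank-strict {x} {x′} op x<x′ = sum-strict (countBefore x) (countBefore x′) (countBefore-mono x<x′) x (opener-counted op x<x′)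

    rank-injective : ∀ {x x′} → isOpener x ≡ true → isOpener x′ ≡ true → rank x ≡ rank x′ → x ≡ x′
    rank-injective {x} {x′} op op′ e with <-cmp (toℕ x) (toℕ x′)
    ... | tri< x<x′ _ _ = ⊥-elim (<-irrefl e (rank-strict op x<x′))
    ... | tri≈ _ x≡x′ _ = toℕ-injective x≡x′
    ... | tri> _ _ x′<x = ⊥-elim (<-irrefl (sym e) (rank-strict op′ x′<x))

    pick : Bool → Fin N → Fin N
    pick true i = i
    pick false i = f i

    openerOf : Fin N → Fin N
    openerOf i = pick (isOpener i) i

    openerOf-isOpener : ∀ i → isOpener (openerOf i) ≡ true
    openerOf-isOpener i = go (isOpener i) refl
      where
      go : ∀ b → isOpener i ≡ b → isOpener (pick b i) ≡ true
      go true e = e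
      go false e = trans (isOpener-partner i) (cong not e)

    openerOf-partner : ∀ i → openerOf (f i) ≡ openerOf i
    openerOf-partner i = trans (cong (λ b → pick b (f i)) (isOpener-partner i)) (go (isOpener i))
      where
      go : ∀ b → pick (not b) (f i) ≡ pick b i
      go true = involutive i
      go false = refl

    pick-injective : ∀ b {i j} → pick b i ≡ pick b j → i ≡ j
    pick-injective true e = e
    pick-injective false {i} {j} e = trans (sym (involutive i)) (trans (cong f e) (involutive j))

    label : Fin N → Fin n
    label i = fromℕ< (rank<n (openerOf i) (openerOf-isOpener i))

    vertex : Fin N → RVertex n
    vertex i = label i , isOpener i

    vertex-partner : ∀ i → vertex (f i) ≡ antipode (vertex i)
    vertex-partner i = cong₂ _,_ (fromℕ<-cong _ _ (cong rank (openerOf-partner i)) _ _) (isOpener-partner i)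

    vertex-injective : ∀ {i j} → vertex i ≡ vertex j → i ≡ j
    vertex-injective {i} {j} e = pick-injective (isOpener i) (begin
        pick (isOpener i) i   ≡⟨ same-opener ⟩
        pick (isOpener j) j   ≡⟨ cong (λ b → pick b j) (cong proj₂ e) ⟨
        pick (isOpener i) j ∎)
      where
      open ≡-Reasoning
      toℕ-label : ∀ i → toℕ (label i) ≡ rank (openerOf i)
      toℕ-label i = toℕ-fromℕ< _
      same-opener : openerOf i ≡ openerOf j
      same-opener = rank-injective (openerOf-isOpener i) (openerOf-isOpener j)
        (trans (sym (toℕ-label i)) (trans (cong (toℕ ∘ proj₁) e) (toℕ-label j)))

    -- vertex is onto by counting; consecutive positions are not antipodal since
    -- f has no chord {i , i + 1}; the endpoints are antipodal since f last = 0
    isPath : IsAntipodalSpanningPath n vertex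
    isPath = record
      { injective = vertex-injective
      ; surjective = injection-onto _≟V_ code code-injective vertex vertex-injective
      ; consecutive = consecutive
      ; endpoints = endpoints
      }
      where
      consecutive : ∀ i j → toℕ j ≡ suc (toℕ i) → RAdj (vertex i) (vertex j)
      consecutive i j e =
          (λ vi≡vj → 1+n≢n (trans (sym e) (cong toℕ (sym (vertex-injective vi≡vj)))))
        , (λ vi≡v̄j → no-step i j e (trans (cong f (vertex-injective (trans vi≡v̄j (sym (vertex-partner j))))) (involutive j)))
      endpoints : ∀ i j → toℕ i ≡ 0 → toℕ j ≡ M → vertex j ≡ antipode (vertex i)
      endpoints i j i≡0 j≡M = begin
          vertex j              ≡⟨ cong vertex (toℕ-injective (trans j≡M (sym toℕ-last))) ⟩
          vertex last           ≡⟨ cong vertex (sym (trans (cong f (sym last↦zero)) (involutive last))) ⟩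
          vertex (f fzero)      ≡⟨ vertex-partner fzero ⟩
          antipode (vertex fzero) ≡⟨ cong (antipode ∘ vertex) (toℕ-injective i≡0) ⟨
          antipode (vertex i) ∎
        where open ≡-Reasoning

    pathOf : Path
    pathOf = vertex , isPath

    partner-pathOf : ∀ i → partner pathOf i ≡ f i
    partner-pathOf i = vertex-injective (trans (at-partner pathOf i) (sym (vertex-partner i)))

  -- For n ≥ 2 a one-loop diagram has a unique loop start s, i.e. m s = rot s,
  -- and rotating s to the last vertex normalises the diagram.
  module Normalisation (2≤M : 2 ≤ M) where

    starts-not-paired : ∀ {m : Fin N → Fin N} → (∀ i → m (m i) ≡ i) →
                        ∀ {s s′} → m s ≡ rot s → m s′ ≡ rot s′ → s′ ≢ m s
    starts-not-paired {m} m² {s} {s′} ms ms′ s′≡ms = rot²-nofix 2≤M s (begin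
        rot (rot s)   ≡⟨ cong rot (trans (sym ms) (sym s′≡ms)) ⟩
        rot s′        ≡⟨ ms′ ⟨
        m s′          ≡⟨ cong m s′≡ms ⟩
        m (m s)       ≡⟨ m² s ⟩
        s ∎)
      where open ≡-Reasoning

    loopStart : (d : Diagram) → Σ (Fin N) λ s → chords d s ≡ rot s
    loopStart (m , cd , i , inj₁ e , _) = i , e
    loopStart (m , cd , i , inj₂ e , _) = m i , trans (IsChordDiagram.involution cd i) e

    start : Diagram → Fin N
    start d = proj₁ (loopStart d)

    -- any loop start lies on the unique loop chord, and cannot be paired with
    -- the chosen one, so it is the chosen one
    loopStart-unique : (d : Diagram) → ∀ {s} → chords d s ≡ rot s → start d ≡ s
    loopStart-unique d@(m , cd , i , _ , unique) {s′} ms′ with unique s (inj₁ ms) | unique s′ (inj₁ ms′)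
      where
      s : Fin N
      s = start d
      ms : m s ≡ rot s
      ms = proj₂ (loopStart d)
    ... | inj₁ s≡i | inj₁ s′≡i = trans s≡i (sym s′≡i)
    ... | inj₂ s≡mi | inj₂ s′≡mi = trans s≡mi (sym s′≡mi)
    ... | inj₁ s≡i | inj₂ s′≡mi = ⊥-elim (starts-not-paired (IsChordDiagram.involution cd) (proj₂ (loopStart d)) ms′
                                    (trans s′≡mi (cong m (sym s≡i))))
    ... | inj₂ s≡mi | inj₁ s′≡i = ⊥-elim (starts-not-paired (IsChordDiagram.involution cd) ms′ (proj₂ (loopStart d))
                                    (trans s≡mi (cong m (sym s′≡i))))

    normalise : (Fin N → Fin N) → Fin N → Fin N → Fin N
    normalise m s j = toLast s (m (fromLast s j))

    normalise-normal : (d : Diagram) → Normal (normalise (chords d) (start d))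
    normalise-normal d@(m , cd , _) = record
      { involutive = involutive ; nofix = nofix ; last↦zero = last↦zero ; no-step = no-step }
      where
      open IsChordDiagram cd
      s : Fin N
      s = start d
      involutive : ∀ i → normalise m s (normalise m s i) ≡ i
      involutive i = trans (cong (toLast s ∘ m) (fromLast-toLast s _)) (trans (cong (toLast s) (involution _)) (toLast-fromLast s i))
      nofix : ∀ i → normalise m s i ≢ i
      nofix i e = noFixed (fromLast s i) (trans (sym (fromLast-toLast s _)) (cong (fromLast s) e))
      last↦zero : normalise m s last ≡ fzero
      last↦zero = begin
          toLast s (m (fromLast s last))  ≡⟨ cong (toLast s ∘ m) (fromLast-self s) ⟩
          toLast s (m s)                  ≡⟨ cong (toLast s) (proj₂ (loopStart d)) ⟩
          toLast s (rot s)                ≡⟨ rot-shift _ s ⟨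
          rot (toLast s s)                ≡⟨ cong rot (toLast-self s) ⟩
          rot last                        ≡⟨ rot-last ⟩
          fzero ∎
        where open ≡-Reasoning
      -- a chord {i , i + 1} would come from a second loop start, forcing i = last
      no-step : ∀ i j → toℕ j ≡ suc (toℕ i) → normalise m s i ≢ j
      no-step i j j≡i+1 e = <-irrefl refl (subst (_< N) (trans j≡i+1 (cong suc (trans (cong toℕ i≡last) toℕ-last))) (toℕ<n j))
        where
        loop : m (fromLast s i) ≡ rot (fromLast s i)
        loop = trans (sym (fromLast-toLast s _)) (trans (cong (fromLast s) (trans e (successor-is-rot i j j≡i+1))) (sym (rot-shift _ i)))
        i≡last : i ≡ last
        i≡last = trans (sym (toLast-fromLast s i)) (trans (cong (toLast s) (sym (loopStart-unique d loop))) (toLast-self s))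

    normalise-rotate : ∀ d₁ d₂ → (∀ i → chords d₂ (rot i) ≡ rot (chords d₁ i)) →
                       ∀ j → normalise (chords d₂) (start d₂) j ≡ normalise (chords d₁) (start d₁) j
    normalise-rotate d₁ d₂ move j = begin
        toLast s₂ (m₂ (fromLast s₂ j))             ≡⟨ cong (λ s → toLast s (m₂ (fromLast s j))) s₂≡rot-s₁ ⟩
        toLast (rot s₁) (m₂ (fromLast (rot s₁) j)) ≡⟨ cong (toLast (rot s₁) ∘ m₂) (fromLast-rot s₁ j) ⟩
        toLast (rot s₁) (m₂ (rot (fromLast s₁ j))) ≡⟨ cong (toLast (rot s₁)) (move (fromLast s₁ j)) ⟩
        toLast (rot s₁) (rot (m₁ (fromLast s₁ j))) ≡⟨ toLast-rot s₁ (m₁ (fromLast s₁ j)) ⟩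
        toLast s₁ (m₁ (fromLast s₁ j)) ∎
      where
      open ≡-Reasoning
      m₁ m₂ : Fin N → Fin N
      m₁ = chords d₁
      m₂ = chords d₂
      s₁ s₂ : Fin N
      s₁ = start d₁
      s₂ = start d₂
      s₂≡rot-s₁ : s₂ ≡ rot s₁
      s₂≡rot-s₁ = loopStart-unique d₂ (trans (move s₁) (cong rot (proj₂ (loopStart d₁))))

    normalise-reflect : ∀ d₁ d₂ → (∀ i → chords d₂ (opposite i) ≡ opposite (chords d₁ i)) →
                        ∀ j → normalise (chords d₂) (start d₂) j ≡ opposite (normalise (chords d₁) (start d₁) (opposite j))
    normalise-reflect d₁@(m₁ , cd₁ , _) d₂ move j = begin
        toLast s₂ (m₂ (fromLast s₂ j))                       ≡⟨ cong (toLast s₂ ∘ m₂) (opposite-opposite _) ⟨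
        toLast s₂ (m₂ (opposite (opposite (fromLast s₂ j)))) ≡⟨ cong (toLast s₂ ∘ m₂ ∘ opposite) (fromLast-opposite {s₁} rot-s₂ j) ⟩
        toLast s₂ (m₂ (opposite (fromLast s₁ (opposite j)))) ≡⟨ cong (toLast s₂) (move (fromLast s₁ (opposite j))) ⟩
        toLast s₂ (opposite (m₁ (fromLast s₁ (opposite j)))) ≡⟨ toLast-opposite {s₁} rot-s₂ (m₁ (fromLast s₁ (opposite j))) ⟩
        opposite (toLast s₁ (m₁ (fromLast s₁ (opposite j)))) ∎
      where
      open ≡-Reasoning
      m₂ : Fin N → Fin N
      m₂ = chords d₂
      s₁ s₂ : Fin N
      s₁ = start d₁
      s₂ = start d₂
      reflected-start : m₂ (opposite (rot s₁)) ≡ rot (opposite (rot s₁))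
      reflected-start = begin
          m₂ (opposite (rot s₁))          ≡⟨ move (rot s₁) ⟩
          opposite (m₁ (rot s₁))          ≡⟨ cong (opposite ∘ m₁) (proj₂ (loopStart d₁)) ⟨
          opposite (m₁ (m₁ s₁))           ≡⟨ cong opposite (IsChordDiagram.involution cd₁ s₁) ⟩
          opposite s₁                     ≡⟨ rot-opposite-rot s₁ ⟨
          rot (opposite (rot s₁)) ∎
      rot-s₂ : rot s₂ ≡ opposite s₁
      rot-s₂ = trans (cong rot (loopStart-unique d₂ reflected-start)) (rot-opposite-rot s₁)

    pathOfDiagram : Diagram → Path
    pathOfDiagram d = PathOfNormal.pathOf (normalise (chords d) (start d)) (normalise-normal d)

    partner-pathOfDiagram : ∀ d i → partner (pathOfDiagram d) i ≡ normalise (chords d) (start d) i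
    partner-pathOfDiagram d = PathOfNormal.partner-pathOf (normalise (chords d) (start d)) (normalise-normal d)

    pathOfDiagram-move : ∀ d₁ d₂ → ChordMove n d₁ d₂ → pathOfDiagram d₁ ≈P pathOfDiagram d₂
    pathOfDiagram-move d₁ d₂ (inj₁ move) = same-diagram⇒≈P (pathOfDiagram d₁) (pathOfDiagram d₂) λ i →
      trans (partner-pathOfDiagram d₂ i) (trans (normalise-rotate d₁ d₂ move i) (sym (partner-pathOfDiagram d₁ i)))
    pathOfDiagram-move d₁ d₂ (inj₂ move) = mirror-diagram⇒≈P (pathOfDiagram d₁) (pathOfDiagram d₂) λ i →
      trans (partner-pathOfDiagram d₂ (opposite i))
        (trans (normalise-reflect d₁ d₂ move (opposite i))
          (cong opposite (trans (cong (normalise (chords d₁) (start d₁)) (opposite-opposite i)) (sym (partner-pathOfDiagram d₁ i)))))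

    pathOfDiagram-cong : ∀ {d₁ d₂} → d₁ ≈D d₂ → pathOfDiagram d₁ ≈P pathOfDiagram d₂
    pathOfDiagram-cong = closure-map pathOfDiagram pathOfDiagram-move

    -- a path is equivalent to the path of its own diagram (whose loop starts at last)
    path-roundtrip : ∀ P → P ≈P pathOfDiagram (pathDiagram P)
    path-roundtrip P = same-diagram⇒≈P P (pathOfDiagram (pathDiagram P)) λ i → begin
        partner (pathOfDiagram (pathDiagram P)) i             ≡⟨ partner-pathOfDiagram (pathDiagram P) i ⟩
        toLast last (partner P (fromLast last i))             ≡⟨ toLast-last (partner P (fromLast last i)) ⟩
        partner P (fromLast last i)                           ≡⟨ cong (partner P) (fromLast-last i) ⟩
        partner P i ∎
      where open ≡-Reasoning

    -- a diagram is a rotation of its normal form, the diagram of its path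
    diagram-roundtrip : ∀ d → d ≈D pathDiagram (pathOfDiagram d)
    diagram-roundtrip d = ≈D-pointwise-rotation (M + a) d (pathDiagram (pathOfDiagram d)) λ j → begin
        partner (pathOfDiagram d) j                  ≡⟨ partner-pathOfDiagram d j ⟩
        toLast s (chords d (fromLast s j))           ≡⟨ shift-mod a (chords d (fromLast s j)) ⟨
        shift (N + a) (chords d (fromLast s j))      ≡⟨ cong (shift (N + a) ∘ chords d) (from≡undo j) ⟩
        shift (N + a) (chords d (shift ((N + a) * M) j)) ≡⟨ chords-rotations (N + a) d j ⟨
        chords (rotations (N + a) d) j ∎
      where
      open ≡-Reasoning
      s : Fin N
      s = start d
      -- toLast s is the shift by a, hence d rotated N + a times is its normal form
      a : ℕ
      a = M ∸ toℕ s
      from≡undo : ∀ j → fromLast s j ≡ shift ((N + a) * M) j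
      from≡undo j = begin
          fromLast s j                                      ≡⟨ shift-undo (N + a) (fromLast s j) ⟨
          shift ((N + a) * M) (shift (N + a) (fromLast s j)) ≡⟨ cong (shift ((N + a) * M)) (shift-mod a (fromLast s j)) ⟩
          shift ((N + a) * M) (toLast s (fromLast s j))     ≡⟨ cong (shift ((N + a) * M)) (toLast-fromLast s j) ⟩
          shift ((N + a) * M) j ∎

mainTheorem7 : (n : ℕ) → 2 ≤ n → Bijection (PathSetoid n) (ChordSetoid n)
mainTheorem7 (suc k) 2≤n = record
  { to = pathDiagram
  ; cong = pathDiagram-cong
  ; bijective = injective , surjective
  }
  where
  open Roberts k
  open Normalisation (≤-trans 2≤n (m≤n+m (suc k) k))
  module Paths = Setoid (PathSetoid n)
  module Diagrams = Setoid (ChordSetoid n)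

  injective : ∀ {P Q} → pathDiagram P ≈D pathDiagram Q → P ≈P Q
  injective {P} {Q} e = Paths.trans (path-roundtrip P) (Paths.trans (pathOfDiagram-cong e) (Paths.sym (path-roundtrip Q)))

  surjective : ∀ d → ∃ λ P → ∀ {Q} → Q ≈P P → pathDiagram Q ≈D d
  surjective d = pathOfDiagram d , λ Q≈P → Diagrams.trans (pathDiagram-cong Q≈P) (Diagrams.sym (diagram-roundtrip d))
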